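{- Let $G$ and $\mathrm{sh}_0$ be as in the context. Every normal subgroup of $G$ that contains $\mathrm{sh}_0(G)$ contains all generators $\Sigma_\alpha$ and $A_\alpha$ such that the address $\alpha$ contains at least one letter $0$.
   Context: Addresses are finite words over $\{0,1\}$, $\varepsilon$ the empty address; $\alpha,\beta$ are incomparable if there is $\gamma$ with $\gamma0$ a prefix of $\alpha$ and $\gamma1$ a prefix of $\beta$, or vice versa. $G$ is the group generated by elements $\Sigma_\alpha, A_\alpha$ ($\alpha\in\{0,1\}^*$) subject to the following relations, where $X,Y$ range over $\{\Sigma,A\}$ and $\alpha,\delta$ over all addresses: (1) $X_\alpha Y_\beta=Y_\beta X_\alpha$ for $\alpha,\beta$ incomparable; (2) $X_{\alpha0\delta}\Sigma_\alpha=\Sigma_\alpha X_{\alpha00\delta}X_{\alpha10\delta}$; (3) $X_{\alpha10\delta}\Sigma_\alpha=\Sigma_\alpha X_{\alpha01\delta}$; (4) $X_{\alpha11\delta}\Sigma_\alpha=\Sigma_\alpha X_{\alpha11\delta}$; (5) $X_{\alpha0\delta}A_\alpha=A_\alpha X_{\alpha00\delta}$; (6) $X_{\alpha10\delta}A_\alpha=A_\alpha X_{\alpha01\delta}$; (7) $X_{\alpha11\delta}A_\alpha=A_\alpha X_{\alpha1\delta}$; (8) $\Sigma_\alpha\Sigma_{\alpha1}\Sigma_\alpha=\Sigma_{\alpha1}\Sigma_\alpha\Sigma_{\alpha1}\Sigma_{\alpha0}$; (9) $\Sigma_\alpha\Sigma_{\alpha1}A_\alpha=A_{\alpha1}\Sigma_\alpha\Sigma_{\alpha0}$;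 (10) $A_\alpha\Sigma_\alpha=\Sigma_{\alpha1}\Sigma_\alpha A_{\alpha1}A_{\alpha0}$. $\mathrm{sh}_0$ is the endomorphism of $G$ with $\Sigma_\alpha\mapsto\Sigma_{0\alpha}$, $A_\alpha\mapsto A_{0\alpha}$. -}

module Defs where

open import Level using (Level; _⊔_) renaming (suc to lsuc)
open import Data.Bool using (Bool; false; true)
open import Data.List using (List; []; _∷_; _++_)
open import Data.Product using (∃; ∃-syntax; _×_)
open import Data.Sum using (_⊎_)
open import Relation.Binary.PropositionalEquality using (_≡_)

-- Addresses: finite words over {0,1}; 0 = false, 1 = true.
Addr : Set
Addr = List Bool

_∙0_ : Addr → Addr → Addr
α ∙0 δ = α ++ (false ∷ δ)

_∙1_ : Addr → Addr → Addr
α ∙1 δ = α ++ (true ∷ δ)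

Incomparable : Addr → Addr → Set
Incomparable α β =
  (∃[ γ ] ∃[ s ] ∃[ t ] (α ≡ γ ∙0 s × β ≡ γ ∙1 t))
  ⊎ (∃[ γ ] ∃[ s ] ∃[ t ] (α ≡ γ ∙1 s × β ≡ γ ∙0 t))

data Letter : Set where
  Σ A : Letter

infixl 7 _·_
data Word : Set where
  gen : Letter → Addr → Word
  e   : Word
  _·_ : Word → Word → Word
  _⁻¹ : Word → Word

S : Addr → Word
S = gen Σ

Aw : Addr → Word
Aw = gen A

-- The congruence presenting G: group axioms + relations (1)–(10).
infix 4 _≈_
data _≈_ : Word → Word → Set where
  ≈-refl  : ∀ {u} → u ≈ u
  ≈-sym   : ∀ {u v} → u ≈ v → v ≈ u
  ≈-trans : ∀ {u v w} → u ≈ v → v ≈ w → u ≈ w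
  ·-cong  : ∀ {u u' v v'} → u ≈ u' → v ≈ v' → u · v ≈ u' · v'
  ⁻¹-cong : ∀ {u v} → u ≈ v → u ⁻¹ ≈ v ⁻¹
  assoc   : ∀ u v w → (u · v) · w ≈ u · (v · w)
  idˡ     : ∀ u → e · u ≈ u
  idʳ     : ∀ u → u · e ≈ u
  invˡ    : ∀ u → u ⁻¹ · u ≈ e
  invʳ    : ∀ u → u · u ⁻¹ ≈ e
  r1  : ∀ X Y α β → Incomparable α β → gen X α · gen Y β ≈ gen Y β · gen X α
  r2  : ∀ X α δ → gen X (α ∙0 δ) · S α ≈ S α · gen X (α ∙0 (false ∷ δ)) · gen X (α ∙1 (false ∷ δ))
  r3  : ∀ X α δ → gen X (α ∙1 (false ∷ δ)) · S α ≈ S α · gen X (α ∙0 (true ∷ δ))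
  r4  : ∀ X α δ → gen X (α ∙1 (true ∷ δ)) · S α ≈ S α · gen X (α ∙1 (true ∷ δ))
  r5  : ∀ X α δ → gen X (α ∙0 δ) · Aw α ≈ Aw α · gen X (α ∙0 (false ∷ δ))
  r6  : ∀ X α δ → gen X (α ∙1 (false ∷ δ)) · Aw α ≈ Aw α · gen X (α ∙0 (true ∷ δ))
  r7  : ∀ X α δ → gen X (α ∙1 (true ∷ δ)) · Aw α ≈ Aw α · gen X (α ∙1 δ)
  r8  : ∀ α → S α · S (α ∙1 []) · S α ≈ S (α ∙1 []) · S α · S (α ∙1 []) · S (α ∙0 [])
  r9  : ∀ α → S α · S (α ∙1 []) · Aw α ≈ Aw (α ∙1 []) · S α · S (α ∙0 [])
  r10 : ∀ α → Aw α · S α ≈ S (α ∙1 []) · S α · Aw (α ∙1 []) · Aw (α ∙0 [])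

sh₀ : Word → Word
sh₀ (gen X α) = gen X (false ∷ α)
sh₀ e = e
sh₀ (u · v) = sh₀ u · sh₀ v
sh₀ (u ⁻¹) = sh₀ u ⁻¹

record IsNormalSubgroup {ℓ : Level} (N : Word → Set ℓ) : Set ℓ where
  field
    respects : ∀ {u v} → u ≈ v → N u → N v
    has-e    : N e
    closed-· : ∀ {u v} → N u → N v → N (u · v)
    closed-⁻¹ : ∀ {u} → N u → N (u ⁻¹)
    conj     : ∀ g {u} → N u → N (g · u · g ⁻¹)

{-# OPTIONS --safe #-}
module Submission where

-- If α = 0δ, then X_α = sh₀(X_δ). Otherwise α starts with 1, and relations (3)
-- and (7) at the root address make X_α a conjugate of a generator whose address still contains
-- a 0: X_{10δ} = Σ_ε X_{01δ} Σ_ε⁻¹, which starts with 0, and X_{11β} = A_ε X_{1β} A_ε⁻¹, which is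
-- one letter shorter.

open import Defs
open import Level using (Level)
open import Data.Bool using (false; true)
open import Data.List using ([]; _∷_)
open import Data.Product using (_×_; _,_)
open import Data.List.Membership.Propositional using (_∈_)
open import Data.List.Relation.Unary.Any using (there)
open import Relation.Binary.Bundles using (Setoid)
import Relation.Binary.Reasoning.Setoid as SetoidReasoning

G : Setoid _ _
G = record
  { Carrier       = Word
  ; _≈_           = _≈_
  ; isEquivalence = record { refl = ≈-refl ; sym = ≈-sym ; trans = ≈-trans }
  }

open SetoidReasoning G

intertwined⇒conjugate : ∀ {u s v} → u · s ≈ s · v → u ≈ s · v · s ⁻¹
intertwined⇒conjugate {u} {s} {v} us≈sv = begin
  u                ≈⟨ ≈-sym (idʳ u) ⟩
  u · e            ≈⟨ ·-cong ≈-refl (≈-sym (invʳ s)) ⟩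
  u · (s · s ⁻¹)   ≈⟨ ≈-sym (assoc u s (s ⁻¹)) ⟩
  u · s · s ⁻¹     ≈⟨ ·-cong us≈sv ≈-refl ⟩
  s · v · s ⁻¹     ∎

module _ {ℓ : Level} {N : Word → Set ℓ} (isNormal : IsNormalSubgroup N) where
  open IsNormalSubgroup isNormal

  intertwined-closed : ∀ {u s v} → u · s ≈ s · v → N v → N u
  intertwined-closed {s = s} us≈sv Nv =
    respects (≈-sym (intertwined⇒conjugate us≈sv)) (conj s Nv)

  module _ (sh₀⊆N : ∀ w → N (sh₀ w)) where

    gen-closed : ∀ X α → false ∈ α → N (gen X α)
    gen-closed X []                 ()
    gen-closed X (true ∷ [])        (there ())
    gen-closed X (false ∷ δ)        _                 = sh₀⊆N (gen X δ)
    gen-closed X (true ∷ false ∷ δ) _                 =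
      intertwined-closed (r3 X [] δ) (sh₀⊆N (gen X (true ∷ δ)))
    gen-closed X (true ∷ true ∷ β)  (there (there p)) =
      intertwined-closed (r7 X [] β) (gen-closed X (true ∷ β) (there p))

lemma4p5 : ∀ {ℓ : Level} (N : Word → Set ℓ) → IsNormalSubgroup N
    → (∀ w → N (sh₀ w))
    → ∀ α → false ∈ α → N (gen Σ α) × N (gen A α)
lemma4p5 N isNormal sh₀⊆N α 0∈α =
  gen-closed isNormal sh₀⊆N Σ α 0∈α , gen-closed isNormal sh₀⊆N A α 0∈α
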